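{- For every integer $k>0$, every deterministic finite automaton recognizing $\mathtt{MODXOR}_k$ has at least $2^{2k}$ states.
   Context: For $k>0$, $\mathtt{MODXOR}_k\subseteq\{0,1\}^*$ is the set of strings of the form $w_0\,x_1\,u_1\,x_2\,u_2\cdots x_m\,u_m$ where $m>0$, $w_0\in\{0,1\}^*$ has length less than $2k$, each $x_i\in\{0,1\}$, each $u_i\in\{0,1\}^{2k-1}$, and $x_1\oplus x_2\oplus\cdots\oplus x_m=1$. -}

module Defs where

open import Data.Nat using (ℕ; suc; _<_; _*_; _∸_)
open import Data.Bool using (Bool; true; false; _xor_)
open import Data.Fin using (Fin)
open import Data.List using (List; []; _∷_; _++_; length; foldr; concatMap; map)
open import Data.Product using (Σ; _×_; _,_; ∃)
open import Relation.Binary.PropositionalEquality using (_≡_)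
open import Function.Bundles using (_⇔_)

-- Binary alphabet {0,1} is represented by Bool (false = 0, true = 1).
Word : Set
Word = List Bool

Block : ℕ → Set
Block k = Σ (Bool × Word) λ { (x , u) → length u ≡ 2 * k ∸ 1 }

blockWord : ∀ {k} → Block k → Word
blockWord ((x , u) , _) = x ∷ u

blockBit : ∀ {k} → Block k → Bool
blockBit ((x , _) , _) = x

xorAll : List Bool → Bool
xorAll = foldr _xor_ false

data MODXOR (k : ℕ) (w : Word) : Set where
  modxor : (w0 : Word) (bs : List (Block k)) →
           length w0 < 2 * k →
           0 < length bs →
           xorAll (map (blockBit {k}) bs) ≡ true →
           w ≡ w0 ++ concatMap (blockWord {k}) bs →
           MODXOR k w

record DFA (n : ℕ) : Set where
  field
    start  : Fin n
    δ      : Fin n → Bool → Fin n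
    accept : Fin n → Bool

  run : Fin n → Word → Fin n
  run q []       = q
  run q (a ∷ w)  = run (δ q a) w

  accepts : Word → Bool
  accepts w = accept (run start w)

Recognizes : ∀ {n} → DFA n → (Word → Set) → Set
Recognizes D L = ∀ w → (DFA.accepts D w ≡ true) ⇔ L w

-- A word v of length 2k followed by j < 2k zeros lies in MODXOR_k exactly when the
-- j-th letter of v is 1: the padded word has length between 2k and 4k, so it splits as
-- w₀ followed by a single block, and that block starts at position j.  Hence a DFA for
-- MODXOR_k can recover every letter of a word of length 2k from the state the word
-- leads to, so the 2^(2k) words of length 2k lead to pairwise distinct states.
module Submission where

open import Defs
open import Data.Nat using (ℕ; zero; suc; _+_; _*_; _∸_; _^_; _<_; _≤_; z≤n; s≤s)
open import Data.Nat.Properties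
open import Data.Bool using (Bool; true; false; _xor_)
open import Data.Bool.Properties using (⇔→≡; xor-identityʳ)
open import Data.Empty using (⊥-elim)
open import Data.Fin as Fin using (Fin; combine; funToFin; finToFun)
open import Data.Fin.Properties using (2↔Bool; injective⇒≤; funToFin-finToFin)
open import Data.List using (List; []; _∷_; _++_; [_]; length; map; replicate; tabulate; concatMap)
open import Data.List.Properties
  using (length-++; length-replicate; length-tabulate; ++-assoc; ++-identityʳ; ∷-injectiveˡ; ∷-injectiveʳ)
open import Data.Product using (_×_; _,_)
open import Function using (_∘_)
open import Function.Bundles using (_⇔_; mk⇔; Injection)
open import Function.Definitions using (Injective)
open import Function.Properties.Equivalence using () renaming (trans to ⇔-trans)
open import Function.Properties.Inverse using (↔⇒↣)
open import Relation.Binary.PropositionalEquality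
  using (_≡_; refl; sym; trans; cong; cong₂; subst; _≗_; module ≡-Reasoning)

funToFin-cong : ∀ {m n} {f g : Fin m → Fin n} → f ≗ g → funToFin f ≡ funToFin g
funToFin-cong {zero}  _   = refl
funToFin-cong {suc m} f≗g = cong₂ combine (f≗g Fin.zero) (funToFin-cong (f≗g ∘ Fin.suc))

finToFun-injective : ∀ {m n} → Injective _≡_ _≗_ (finToFun {m} {n})
finToFun-injective {m} {n} {i} {j} i≗j = begin
  i                              ≡⟨ funToFin-finToFin {n} {m} i ⟨
  funToFin (finToFun {m} {n} i)  ≡⟨ funToFin-cong i≗j ⟩
  funToFin (finToFun {m} {n} j)  ≡⟨ funToFin-finToFin {n} {m} j ⟩
  j                              ∎
  where open ≡-Reasoning

injective⇒2^≤ : ∀ {N n} (f : (Fin N → Bool) → Fin n) → Injective _≗_ _≡_ f → 2 ^ N ≤ n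
injective⇒2^≤ {N} f f-injective =
  injective⇒≤ {f = f ∘ bits} λ same → finToFun-injective λ j → toBool-injective (f-injective same j)
  where
  open Injection (↔⇒↣ 2↔Bool) using () renaming (to to toBool; injective to toBool-injective)
  bits : Fin (2 ^ N) → Fin N → Bool
  bits i = toBool ∘ finToFun i

tabulate-injective : ∀ {A : Set} {n} → Injective _≗_ _≡_ (tabulate {A = A} {n = n})
tabulate-injective {n = suc n} eq Fin.zero    = ∷-injectiveˡ eq
tabulate-injective {n = suc n} eq (Fin.suc i) = tabulate-injective (∷-injectiveʳ eq) i

++-injectiveʳ : ∀ {A : Set} (xs xs' : List A) {ys ys'} →
                length xs ≡ length xs' → xs ++ ys ≡ xs' ++ ys' → ys ≡ ys'
++-injectiveʳ []       []        _   eq = eq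
++-injectiveʳ (x ∷ xs) (x' ∷ xs') len eq =
  ++-injectiveʳ xs xs' (suc-injective len) (∷-injectiveʳ eq)

-- Uniqueness of quotient and remainder for division by c.
quotient-≡1 : ∀ {a b c} m → a < c → b < c → a + m * c ≡ c + b → m ≡ 1 × a ≡ b
quotient-≡1 {a} {b} {c} zero a<c _ eq =
  ⊥-elim (<⇒≱ a<c (≤-trans (m≤m+n c b) (≤-reflexive (trans (sym eq) (+-identityʳ a)))))
quotient-≡1 {a} {b} {c} 1 _ _ eq =
  refl , +-cancelˡ-≡ c a b (trans (+-comm c a) (trans (cong (a +_) (sym (+-identityʳ c))) eq))
quotient-≡1 {a} {b} {c} (suc (suc m)) _ b<c eq = ⊥-elim (<-irrefl refl (begin-strict
  c + b                      <⟨ +-monoʳ-< c b<c ⟩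
  c + c                      ≤⟨ +-monoʳ-≤ c (m≤m+n c (m * c)) ⟩
  c + (c + m * c)            ≤⟨ m≤n+m _ a ⟩
  a + (c + (c + m * c))      ≡⟨ eq ⟩
  c + b                      ∎))
  where open ≤-Reasoning

zeros : ℕ → Word
zeros j = replicate j false

block-length : ∀ {k} → 0 < k → suc (2 * k ∸ 1) ≡ 2 * k
block-length {suc k} _ = refl

length-blocks : ∀ {k} → 0 < k → (bs : List (Block k)) →
                length (concatMap (blockWord {k}) bs) ≡ length bs * (2 * k)
length-blocks k>0 []                   = refl
length-blocks k>0 (((x , u) , |u|) ∷ bs) =
  trans (length-++ (x ∷ u)) (cong₂ _+_ (trans (cong suc |u|) (block-length k>0)) (length-blocks k>0 bs))

padded : Word → Bool → Word → Word
padded p x s = (p ++ x ∷ s) ++ zeros (length p)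

module _ {k} (k>0 : 0 < k) (p : Word) (x : Bool) (s : Word) (|pxs| : length (p ++ x ∷ s) ≡ 2 * k) where

  private
    padded-assoc : padded p x s ≡ p ++ x ∷ (s ++ zeros (length p))
    padded-assoc = ++-assoc p (x ∷ s) (zeros (length p))

    |p|<2k : length p < 2 * k
    |p|<2k = subst (length p <_) (trans (sym (length-++ p)) |pxs|) (m<m+n (length p) (s≤s z≤n))

    length-padded : length (padded p x s) ≡ 2 * k + length p
    length-padded = trans (length-++ (p ++ x ∷ s)) (cong₂ _+_ |pxs| (length-replicate (length p)))

  padded∈MODXOR : x ≡ true → MODXOR k (padded p x s)
  padded∈MODXOR refl = modxor p (block ∷ []) |p|<2k (s≤s z≤n) refl
    (trans padded-assoc (cong (λ w → p ++ true ∷ w) (sym (++-identityʳ _))))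
    where
    |s++zeros| : length (s ++ zeros (length p)) ≡ 2 * k ∸ 1
    |s++zeros| = cong (_∸ 1) (begin
      suc (length (s ++ zeros (length p)))            ≡⟨ cong suc (length-++ s) ⟩
      suc (length s + length (zeros (length p)))      ≡⟨ cong (λ t → suc (length s + t)) (length-replicate (length p)) ⟩
      suc (length s + length p)                       ≡⟨ cong suc (+-comm (length s) (length p)) ⟩
      suc (length p + length s)                       ≡⟨ +-suc (length p) (length s) ⟨
      length p + suc (length s)                       ≡⟨ length-++ p ⟨
      length (p ++ x ∷ s)                             ≡⟨ |pxs| ⟩
      2 * k                                           ∎)
      where open ≡-Reasoning

    block : Block k
    block = (true , s ++ zeros (length p)) , |s++zeros|

  padded∈MODXOR⇒ : MODXOR k (padded p x s) → x ≡ true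
  padded∈MODXOR⇒ (modxor w0 bs |w0|<2k _ xor≡true eq) with quotient-≡1 (length bs) |w0|<2k |p|<2k lengths
    where
    lengths : length w0 + length bs * (2 * k) ≡ 2 * k + length p
    lengths = begin
      length w0 + length bs * (2 * k)                    ≡⟨ cong (length w0 +_) (length-blocks k>0 bs) ⟨
      length w0 + length (concatMap (blockWord {k}) bs)  ≡⟨ length-++ w0 ⟨
      length (w0 ++ concatMap (blockWord {k}) bs)        ≡⟨ cong length eq ⟨
      length (padded p x s)                              ≡⟨ length-padded ⟩
      2 * k + length p                                   ∎
      where open ≡-Reasoning
  ... | |bs|≡1 , |w0|≡|p| = single-block bs |bs|≡1 xor≡true eq
    where
    single-block : ∀ bs → length bs ≡ 1 → xorAll (map (blockBit {k}) bs) ≡ true →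
                   padded p x s ≡ w0 ++ concatMap (blockWord {k}) bs → x ≡ true
    single-block []                    ()
    single-block (_ ∷ _ ∷ _)           ()
    single-block (((y , u) , _) ∷ []) _ xor≡true eq = begin
      x            ≡⟨ ∷-injectiveˡ (++-injectiveʳ p w0 (sym |w0|≡|p|) (trans (sym padded-assoc) eq)) ⟩
      y            ≡⟨ xor-identityʳ y ⟨
      y xor false  ≡⟨ xor≡true ⟩
      true         ∎
      where open ≡-Reasoning

  padded∈MODXOR⇔ : MODXOR k (padded p x s) ⇔ x ≡ true
  padded∈MODXOR⇔ = mk⇔ padded∈MODXOR⇒ padded∈MODXOR

module _ {n} (D : DFA n) where
  open DFA D

  run-++ : ∀ q v w → run q (v ++ w) ≡ run (run q v) w
  run-++ q []      w = refl
  run-++ q (a ∷ v) w = run-++ (δ q a) v w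

  run-≡⇒accepts-++-≡ : ∀ v v' w → run start v ≡ run start v' → accepts (v ++ w) ≡ accepts (v' ++ w)
  run-≡⇒accepts-++-≡ v v' w same = begin
    accept (run start (v ++ w))    ≡⟨ cong accept (run-++ start v w) ⟩
    accept (run (run start v) w)   ≡⟨ cong (λ q → accept (run q w)) same ⟩
    accept (run (run start v') w)  ≡⟨ cong accept (run-++ start v' w) ⟨
    accept (run start (v' ++ w))   ∎
    where open ≡-Reasoning

module _ {k n} (k>0 : 0 < k) (D : DFA n) (D-recognizes : Recognizes D (MODXOR k)) where
  open DFA D

  accepts-padded : ∀ p x s → length (p ++ x ∷ s) ≡ 2 * k → accepts (padded p x s) ≡ x
  accepts-padded p x s |pxs| = ⇔→≡ (⇔-trans (D-recognizes _) (padded∈MODXOR⇔ k>0 p x s |pxs|))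

  run-≡⇒suffix-≡ : ∀ p {v v'} → length (p ++ v) ≡ 2 * k → length v ≡ length v' →
                   run start (p ++ v) ≡ run start (p ++ v') → v ≡ v'
  run-≡⇒suffix-≡ p {[]}    {[]}      _     _     _    = refl
  run-≡⇒suffix-≡ p {x ∷ s} {x' ∷ s'} |pxs| |xs|≡|x's'| same =
    cong₂ _∷_ x≡x' (run-≡⇒suffix-≡ (p ++ [ x ]) |px++s| (suc-injective |xs|≡|x's'|) same-after-x)
    where
    |px's'| : length (p ++ x' ∷ s') ≡ 2 * k
    |px's'| = begin
      length (p ++ x' ∷ s')        ≡⟨ length-++ p ⟩
      length p + length (x' ∷ s')  ≡⟨ cong (length p +_) |xs|≡|x's'| ⟨
      length p + length (x ∷ s)    ≡⟨ length-++ p ⟨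
      length (p ++ x ∷ s)          ≡⟨ |pxs| ⟩
      2 * k                        ∎
      where open ≡-Reasoning

    x≡x' : x ≡ x'
    x≡x' = begin
      x                         ≡⟨ accepts-padded p x s |pxs| ⟨
      accepts (padded p x s)    ≡⟨ run-≡⇒accepts-++-≡ D (p ++ x ∷ s) (p ++ x' ∷ s') (zeros (length p)) same ⟩
      accepts (padded p x' s')  ≡⟨ accepts-padded p x' s' |px's'| ⟩
      x'                        ∎
      where open ≡-Reasoning

    |px++s| : length ((p ++ [ x ]) ++ s) ≡ 2 * k
    |px++s| = trans (cong length (++-assoc p [ x ] s)) |pxs|

    same-after-x : run start ((p ++ [ x ]) ++ s) ≡ run start ((p ++ [ x ]) ++ s')
    same-after-x = begin
      run start ((p ++ [ x ]) ++ s)   ≡⟨ cong (run start) (++-assoc p [ x ] s) ⟩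
      run start (p ++ x ∷ s)          ≡⟨ same ⟩
      run start (p ++ x' ∷ s')        ≡⟨ cong (λ y → run start (p ++ y ∷ s')) x≡x' ⟨
      run start (p ++ x ∷ s')         ≡⟨ cong (run start) (++-assoc p [ x ] s') ⟨
      run start ((p ++ [ x ]) ++ s')  ∎
      where open ≡-Reasoning

theorem9 : (k : ℕ) → 0 < k → (n : ℕ) (D : DFA n) →
           Recognizes D (MODXOR k) → 2 ^ (2 * k) ≤ n
theorem9 k k>0 n D D-recognizes = injective⇒2^≤ (run start ∘ tabulate) λ {b} {b'} same →
  tabulate-injective (run-≡⇒suffix-≡ k>0 D D-recognizes []
    (length-tabulate b) (trans (length-tabulate b) (sym (length-tabulate b'))) same)
  where open DFA D
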